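{- Let $\mathscr{C}=\{f_i:i\in\mathbb{N}\}$ be a computably enumerable class of total computable functions and $h$ a computable order. Then the property $f\in A_{\mathscr{C},h}$, for $f\in\mathscr{C}$, is decidable given any $\mathscr{C}$-index of $f$: there is a total computable procedure which on input any $i\in\mathbb{N}$ outputs whether $f_i\in A_{\mathscr{C},h}$.
   Context: $\mathscr{C}$ is computably enumerable means there is a numbering $\mathscr{C}=\{f_i:i\in\mathbb{N}\}$ such that $(i,n)\mapsto f_i(n)$ is computable; any $i$ with $f=f_i$ is a $\mathscr{C}$-index of $f$. For $f\in\mathbb{N}^\mathbb{N}$, $f\restriction n=(f(0),\dots,f(n-1))$, and $f$ extends $v\in\mathbb{N}^*$ of length $n$ if $f\restriction n=v$. For a finite sequence $v$, $K_\mathscr{C}(v)=\min\{i:f_i\text{ extends }v\}$. A computable order is a computable, non-decreasing, unbounded function $h:\mathbb{N}\to\mathbb{N}$. $A_{\mathscr{C},h}=\{f:\mathbb{N}\to\mathbb{N}:\forall n,\ K_\mathscr{C}(f\restriction n)\le h(n)\}$. -}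

module Defs where

open import Data.Nat using (ℕ; _≤_; _<_)
open import Data.Fin using (toℕ)
open import Data.Vec using (Vec; tabulate)
open import Data.Product using (Σ; ∃; _×_)
open import Relation.Binary.PropositionalEquality using (_≡_)
open import Relation.Nullary using (¬_)

-- A numbering of a class C = { f i : i ∈ ℕ }; (i , n) ↦ f i n is an Agda
-- (hence computable) function.  "Computably enumerable class of total
-- computable functions" is thus represented by  f : ℕ → ℕ → ℕ.
Numbering : Set
Numbering = ℕ → ℕ → ℕ

_↾_ : (ℕ → ℕ) → (n : ℕ) → Vec ℕ n
g ↾ n = tabulate (λ k → g (toℕ k))

Extends : (ℕ → ℕ) → {n : ℕ} → Vec ℕ n → Set
Extends g {n} v = g ↾ n ≡ v

IsK : Numbering → {n : ℕ} → Vec ℕ n → ℕ → Set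
IsK C v k = Extends (C k) v × (∀ j → j < k → ¬ Extends (C j) v)

-- K_C(v) ≤ b  (false when no f_i extends v, i.e. K_C(v) = ∞)
K≤ : Numbering → {n : ℕ} → Vec ℕ n → ℕ → Set
K≤ C v b = ∃ λ k → IsK C v k × k ≤ b

record ComputableOrder (h : ℕ → ℕ) : Set where
  field
    nondecreasing : ∀ m n → m ≤ n → h m ≤ h n
    unbounded     : ∀ m → ∃ λ n → m ≤ h n

InA : Numbering → (ℕ → ℕ) → (ℕ → ℕ) → Set
InA C h g = ∀ n → K≤ C (g ↾ n) (h n)

module Submission where

-- Two observations reduce the question to finitely many decidable checks.
-- (1) K_C(v) ≤ b  iff  some index j ≤ b has f_j extending v: a witness
--     j ≤ b yields a least one by bounded search, since "f_j extends v"
--     is decidable (it compares two finite vectors).  Hence K_C(v) ≤ b is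
--     decidable for every v and b.
-- (2) f_i always extends its own prefixes, so K_C(f_i ↾ n) ≤ i for every n.
--     As h is unbounded, i ≤ h N for some N, and as h is non-decreasing the
--     condition K_C(f_i ↾ n) ≤ h n holds automatically for all n ≥ N.
-- So f_i ∈ A_{C,h} iff the condition holds for the finitely many n < N,
-- which is decided by a bounded universal quantifier.

open import Defs
open import Data.Nat using (ℕ; zero; suc; _≤_; _<_; z≤n; s≤s; _<?_)
open import Data.Nat.Properties
  using (_≟_; ≤-trans; ≮⇒≥; anyUpTo?; allUpTo?)
open import Data.Vec using (Vec)
open import Data.Vec.Properties using (≡-dec)
open import Data.Product using (Σ; ∃; _×_; _,_)
open import Relation.Binary.PropositionalEquality using (refl)
open import Relation.Nullary using (Dec; yes; no; ¬_)
import Relation.Nullary.Decidable as Dec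
open import Function.Bundles using (_⇔_; mk⇔; Equivalence)
open import Function.Properties.Equivalence using () renaming (sym to ⇔-sym)

leastWitness : (P : ℕ → Set) → (∀ j → Dec (P j)) → (i : ℕ) → P i →
  Σ ℕ λ k → (P k × (∀ j → j < k → ¬ P j)) × k ≤ i
leastWitness P P? zero p = zero , (p , λ _ ()) , z≤n
leastWitness P P? (suc i) p with P? zero
... | yes p0 = zero , (p0 , λ _ ()) , z≤n
... | no ¬p0 with leastWitness (λ j → P (suc j)) (λ j → P? (suc j)) i p
... | k , (pk , below-k) , k≤i = suc k , (pk , below-suck) , s≤s k≤i
  where
  below-suck : ∀ j → j < suc k → ¬ P j
  below-suck zero    _         = ¬p0
  below-suck (suc j) (s≤s j<k) = below-k j j<k

extends? : (C : Numbering) {n : ℕ} (v : Vec ℕ n) (j : ℕ) → Dec (Extends (C j) v)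
extends? C {n} v j = ≡-dec _≟_ (C j ↾ n) v

K≤⇔extender : (C : Numbering) {n : ℕ} (v : Vec ℕ n) (b : ℕ) →
  K≤ C v b ⇔ (∃ λ j → j < suc b × Extends (C j) v)
K≤⇔extender C v b = mk⇔ to from
  where
  to : K≤ C v b → ∃ λ j → j < suc b × Extends (C j) v
  to (k , (ext , _) , k≤b) = k , s≤s k≤b , ext

  from : (∃ λ j → j < suc b × Extends (C j) v) → K≤ C v b
  from (j , s≤s j≤b , ext) with leastWitness _ (extends? C v) j ext
  ... | k , isK , k≤j = k , isK , ≤-trans k≤j j≤b

K≤? : (C : Numbering) {n : ℕ} (v : Vec ℕ n) (b : ℕ) → Dec (K≤ C v b)
K≤? C v b =
  Dec.map (⇔-sym (K≤⇔extender C v b)) (anyUpTo? (extends? C v) (suc b))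

K≤-own-prefix : (C : Numbering) (i n b : ℕ) → i ≤ b → K≤ C (C i ↾ n) b
K≤-own-prefix C i n b i≤b =
  Equivalence.from (K≤⇔extender C (C i ↾ n) b) (i , s≤s i≤b , refl)

-- Once i ≤ h N, membership of f_i in A_{C,h} only depends on the prefixes
-- of length below N: the remaining conditions hold by monotonicity of h.
InA⇔below : (C : Numbering) (h : ℕ → ℕ) → ComputableOrder h →
  (i N : ℕ) → i ≤ h N →
  InA C h (C i) ⇔ (∀ {n} → n < N → K≤ C (C i ↾ n) (h n))
InA⇔below C h ord i N i≤hN = mk⇔ (λ inA {n} _ → inA n) from
  where
  open ComputableOrder ord

  from : (∀ {n} → n < N → K≤ C (C i ↾ n) (h n)) → InA C h (C i)
  from below n with n <? N
  ... | yes n<N = below n<N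
  ... | no  n≮N = K≤-own-prefix C i n (h n)
                    (≤-trans i≤hN (nondecreasing N n (≮⇒≥ n≮N)))

mainTheorem2 : (C : Numbering) (h : ℕ → ℕ) → ComputableOrder h →
    (i : ℕ) → Dec (InA C h (C i))
mainTheorem2 C h ord i with ComputableOrder.unbounded ord i
... | N , i≤hN =
  Dec.map (⇔-sym (InA⇔below C h ord i N i≤hN))
          (allUpTo? (λ n → K≤? C (C i ↾ n) (h n)) N)
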